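{- There exists a measurable spined category $(\mathcal{C},\Omega,\mathfrak{P})$ in which the generalized clique number $\omega$ is defined for every object but the assignment $X\mapsto\omega(X)$ is not (the object map of) an S-functor.
   Context: A spined category is a triple $(\mathcal{C},\Omega,\mathfrak{P})$: a category $\mathcal{C}$, a sequence of objects $(\Omega_n)_{n\in\mathbb{N}}$, and an operation $\mathfrak{P}$ assigning to each span $G\xleftarrow{g}\Omega_n\xrightarrow{h}H$ an object $\mathfrak{P}(g,h)$ and morphisms $\mathfrak{P}(g,h)_g:G\to\mathfrak{P}(g,h)$, $\mathfrak{P}(g,h)_h:H\to\mathfrak{P}(g,h)$ with $\mathfrak{P}(g,h)_gg=\mathfrak{P}(g,h)_hh$, such that (SC1) every object has a morphism to some $\Omega_n$; (SC2) for every such span and all $g':G\to G'$, $h':H\to H'$ there is a unique morphism $(g',h'):\mathfrak{P}(g,h)\to\mathfrak{P}(g'g,h'h)$ with $(g',h')\mathfrak{P}(g,h)_g=\mathfrak{P}(g'g,h'h)_{g'g}g'$ and $(g',h')\mathfrak{P}(g,h)_h=\mathfrak{P}(g'g,h'h)_{h'h}h'$. The generalized clique number $\omega(X)$ is the largest $n$ such that there is a morphism $\Omega_n\to X$. An S-functor is a functor $F$ to the poset $(\mathbb{N},\le)$ with $F(\Omega_n)=n$ and $F(\mathfrak{P}(g,h))=\max\{F(G),F(H)\}$ for every span $G\xleftarrow{g}\Omega_n\xrightarrow{h}H$; measurable means at least one S-functor exists. -}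

module Defs where

open import Data.Nat using (ℕ; _≤_; _⊔_)
open import Data.Product using (Σ; _×_)
open import Relation.Binary.PropositionalEquality using (_≡_)
open import Relation.Nullary using (¬_)

record Category : Set₁ where
  infixr 9 _∘_
  field
    Obj : Set
    Hom : Obj → Obj → Set
    id  : ∀ {A} → Hom A A
    _∘_ : ∀ {A B C} → Hom B C → Hom A B → Hom A C
    identityˡ : ∀ {A B} (f : Hom A B) → id ∘ f ≡ f
    identityʳ : ∀ {A B} (f : Hom A B) → f ∘ id ≡ f
    assoc : ∀ {A B C D} (f : Hom C D) (g : Hom B C) (h : Hom A B) →
            (f ∘ g) ∘ h ≡ f ∘ (g ∘ h)

record SpinedCategory : Set₁ where
  field
    cat : Category
  open Category cat public
  field
    Ω : ℕ → Obj
    𝔓 : ∀ {n G H} → Hom (Ω n) G → Hom (Ω n) H → Obj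
    𝔓₁ : ∀ {n G H} (g : Hom (Ω n) G) (h : Hom (Ω n) H) → Hom G (𝔓 g h)
    𝔓₂ : ∀ {n G H} (g : Hom (Ω n) G) (h : Hom (Ω n) H) → Hom H (𝔓 g h)
    𝔓-comm : ∀ {n G H} (g : Hom (Ω n) G) (h : Hom (Ω n) H) →
             𝔓₁ g h ∘ g ≡ 𝔓₂ g h ∘ h
    SC1 : ∀ (X : Obj) → Σ ℕ (λ n → Hom X (Ω n))
    SC2 : ∀ {n G H G' H'} (g : Hom (Ω n) G) (h : Hom (Ω n) H)
            (g' : Hom G G') (h' : Hom H H') →
            Hom (𝔓 g h) (𝔓 (g' ∘ g) (h' ∘ h))
    SC2-eq₁ : ∀ {n G H G' H'} (g : Hom (Ω n) G) (h : Hom (Ω n) H)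
            (g' : Hom G G') (h' : Hom H H') →
            SC2 g h g' h' ∘ 𝔓₁ g h ≡ 𝔓₁ (g' ∘ g) (h' ∘ h) ∘ g'
    SC2-eq₂ : ∀ {n G H G' H'} (g : Hom (Ω n) G) (h : Hom (Ω n) H)
            (g' : Hom G G') (h' : Hom H H') →
            SC2 g h g' h' ∘ 𝔓₂ g h ≡ 𝔓₂ (g' ∘ g) (h' ∘ h) ∘ h'
    SC2-unique : ∀ {n G H G' H'} (g : Hom (Ω n) G) (h : Hom (Ω n) H)
            (g' : Hom G G') (h' : Hom H H')
            (m : Hom (𝔓 g h) (𝔓 (g' ∘ g) (h' ∘ h))) →
            m ∘ 𝔓₁ g h ≡ 𝔓₁ (g' ∘ g) (h' ∘ h) ∘ g' →
            m ∘ 𝔓₂ g h ≡ 𝔓₂ (g' ∘ g) (h' ∘ h) ∘ h' →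
            m ≡ SC2 g h g' h'

module _ (S : SpinedCategory) where
  open SpinedCategory S

  IsCliqueNumber : Obj → ℕ → Set
  IsCliqueNumber X n = Hom (Ω n) X × (∀ m → Hom (Ω m) X → m ≤ n)

  CliqueNumberDefined : Set
  CliqueNumberDefined = ∀ X → Σ ℕ (IsCliqueNumber X)

  -- An S-functor: a functor into the poset (ℕ, ≤) (functoriality is
  -- automatic in a poset, so only monotonicity along morphisms is data).
  record SFunctor : Set where
    field
      F₀ : Obj → ℕ
      F₁ : ∀ {X Y} → Hom X Y → F₀ X ≤ F₀ Y
      F-Ω : ∀ n → F₀ (Ω n) ≡ n
      F-𝔓 : ∀ {n G H} (g : Hom (Ω n) G) (h : Hom (Ω n) H) →
            F₀ (𝔓 g h) ≡ F₀ G ⊔ F₀ H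

  Measurable : Set
  Measurable = SFunctor

  CliqueNumberIsSFunctor : Set
  CliqueNumberIsSFunctor =
    Σ SFunctor (λ F → ∀ X n → IsCliqueNumber X n → SFunctor.F₀ F X ≡ n)

module Submission where

open import Defs
open import Data.Nat using (ℕ; _≤_; _⊔_; z≤n)
open import Data.Nat.Properties using (≤-refl; ≤-trans; ≤-irrelevant; m≤m⊔n; m≤n⊔m; ⊔-mono-≤)
open import Data.Product using (Σ; _×_; _,_)
open import Level using (0ℓ)
open import Relation.Binary using (Rel; IsPreorder)
open import Relation.Binary.Definitions using (Irrelevant)
open import Relation.Binary.PropositionalEquality using (_≡_; _≢_; refl; sym; cong₂; isEquivalence; module ≡-Reasoning)
open import Relation.Nullary using (¬_)

-- Objects are pairs lo ≤ hi ordered componentwise, with Ω n = (n , n) and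
-- 𝔓 g h the diagonal object (m , m) for m the larger of the two hi's. The
-- clique number is then lo, while hi is an S-functor. Gluing (0 , 1) to
-- itself over Ω 0 produces Ω 1, whose clique number 1 is not the maximum 0
-- of the clique numbers of the pieces.

thinCategory : {A : Set} {_≲_ : Rel A 0ℓ} →
               IsPreorder _≡_ _≲_ → Irrelevant _≲_ → Category
thinCategory {A} {_≲_} isPreorder irrelevant = record
  { Obj = A
  ; Hom = _≲_
  ; id = refl′
  ; _∘_ = λ g f → trans′ f g
  ; identityˡ = λ _ → irrelevant _ _
  ; identityʳ = λ _ → irrelevant _ _
  ; assoc = λ _ _ _ → irrelevant _ _
  }
  where open IsPreorder isPreorder renaming (refl to refl′; trans to trans′)

module _ (S : SpinedCategory) where
  open SpinedCategory S

  cliqueNumber-not-SFunctor :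
    ∀ {n G H a b c} (g : Hom (Ω n) G) (h : Hom (Ω n) H) →
    IsCliqueNumber S G a → IsCliqueNumber S H b → IsCliqueNumber S (𝔓 g h) c →
    c ≢ a ⊔ b → ¬ CliqueNumberIsSFunctor S
  cliqueNumber-not-SFunctor {G = G} {H} g h ωG ωH ω𝔓 c≢a⊔b (F , F≡ω) =
    c≢a⊔b (begin
      _               ≡⟨ sym (F≡ω (𝔓 g h) _ ω𝔓) ⟩
      F₀ (𝔓 g h)      ≡⟨ F-𝔓 g h ⟩
      F₀ G ⊔ F₀ H     ≡⟨ cong₂ _⊔_ (F≡ω G _ ωG) (F≡ω H _ ωH) ⟩
      _               ∎)
    where
    open SFunctor F
    open ≡-Reasoning

record Interval : Set where
  constructor interval
  field
    lo hi : ℕ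
    lo≤hi : lo ≤ hi
open Interval

diagonal : ℕ → Interval
diagonal n = interval n n ≤-refl

record _≼_ (X Y : Interval) : Set where
  constructor _,_
  field
    lo-mono : lo X ≤ lo Y
    hi-mono : hi X ≤ hi Y
open _≼_

≼-isPreorder : IsPreorder _≡_ _≼_
≼-isPreorder = record
  { isEquivalence = isEquivalence
  ; reflexive = λ { refl → ≤-refl , ≤-refl }
  ; trans = λ (l₁ , h₁) (l₂ , h₂) → ≤-trans l₁ l₂ , ≤-trans h₁ h₂
  }

≼-irrelevant : Irrelevant _≼_
≼-irrelevant (l₁ , h₁) (l₂ , h₂) = cong₂ _,_ (≤-irrelevant l₁ l₂) (≤-irrelevant h₁ h₂)

join : Interval → Interval → Interval
join G H = diagonal (hi G ⊔ hi H)

≼-joinˡ : ∀ G H → G ≼ join G H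
≼-joinˡ G H = ≤-trans (lo≤hi G) (m≤m⊔n (hi G) (hi H)) , m≤m⊔n (hi G) (hi H)

≼-joinʳ : ∀ G H → H ≼ join G H
≼-joinʳ G H = ≤-trans (lo≤hi H) (m≤n⊔m (hi G) (hi H)) , m≤n⊔m (hi G) (hi H)

join-mono : ∀ {G H G′ H′} → G ≼ G′ → H ≼ H′ → join G H ≼ join G′ H′
join-mono (_ , g) (_ , h) = ⊔-mono-≤ g h , ⊔-mono-≤ g h

intervals : SpinedCategory
intervals = record
  { cat = thinCategory ≼-isPreorder ≼-irrelevant
  ; Ω = diagonal
  ; 𝔓 = λ {_} {G} {H} _ _ → join G H
  ; 𝔓₁ = λ {_} {G} {H} _ _ → ≼-joinˡ G H
  ; 𝔓₂ = λ {_} {G} {H} _ _ → ≼-joinʳ G H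
  ; 𝔓-comm = λ _ _ → ≼-irrelevant _ _
  ; SC1 = λ X → hi X , lo≤hi X , ≤-refl
  ; SC2 = λ _ _ g′ h′ → join-mono g′ h′
  ; SC2-eq₁ = λ _ _ _ _ → ≼-irrelevant _ _
  ; SC2-eq₂ = λ _ _ _ _ → ≼-irrelevant _ _
  ; SC2-unique = λ _ _ _ _ _ _ _ → ≼-irrelevant _ _
  }

hi-SFunctor : SFunctor intervals
hi-SFunctor = record
  { F₀ = hi
  ; F₁ = hi-mono
  ; F-Ω = λ _ → refl
  ; F-𝔓 = λ _ _ → refl
  }

lo-isCliqueNumber : ∀ X → IsCliqueNumber intervals X (lo X)
lo-isCliqueNumber X = (≤-refl , lo≤hi X) , λ _ → lo-mono

proposition3p11 : Σ SpinedCategory (λ S → Measurable S × CliqueNumberDefined S × ¬ CliqueNumberIsSFunctor S)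
proposition3p11 =
  intervals ,
  hi-SFunctor ,
  (λ X → lo X , lo-isCliqueNumber X) ,
  cliqueNumber-not-SFunctor intervals Ω₀≼X Ω₀≼X
    (lo-isCliqueNumber X) (lo-isCliqueNumber X) (lo-isCliqueNumber (join X X)) λ ()
  where
  X : Interval
  X = interval 0 1 z≤n

  Ω₀≼X : diagonal 0 ≼ X
  Ω₀≼X = z≤n , z≤n
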